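{- Let $\mathcal F$ be a group pair, and suppose the set $A$ of frame relations contains the identity relation $\mathrm{id}_U$ on the base set $U=\bigcup_{x\in I}G_x$. Then for any $(x,y)\in\mathcal E$ the following are equivalent: (i) $R_{xy,\alpha}^{ -1}\in A$ for some $\alpha<\kappa_{xy}$; (ii) $R_{xy,\alpha}^{ -1}\in A$ for all $\alpha<\kappa_{xy}$.
   Context: A group pair consists of the following data. - Pairwise disjoint groups $G_x$ ($x\in I$). - An equivalence relation $\mathcal E$ on $I$. - For each $(x,y)\in\mathcal E$, an isomorphism $\varphi_{xy}:G_x/H_{xy}\to G_y/K_{xy}$, where $H_{xy}\trianglelefteq G_x$ and $K_{xy}\trianglelefteq G_y$. For each $(x,y)\in\mathcal E$ fix an enumeration without repetitions $\langle H_{xy,\gamma}:\gamma<\kappa_{xy}\rangle$ of the cosets of $H_{xy}$, with $H_{xy,0}=H_{xy}$, and put $K_{xy,\gamma}=\varphi_{xy}(H_{xy,\gamma})$. Let $R_{xy,\alpha}=\bigcup_\gamma H_{xy,\gamma}\times(K_{xy,\gamma}\circ K_{xy,\alpha})$, where $\circ$ is the complex product. The set $A$ of frame relations is the set of all unions of subfamilies of these relations. $R^{ -1}$ is relational converse. -}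

module Defs where

open import Level using (0ℓ)
open import Data.Product using (Σ; ∃; ∃-syntax; _×_; _,_; proj₁)
open import Relation.Binary.PropositionalEquality using (_≡_)
open import Relation.Binary.Structures using (IsEquivalence)
open import Algebra.Structures using (IsGroup)
open import Function.Bundles using (_⇔_)

record PGroup : Set₁ where
  infixl 7 _∙_
  infix 8 _⁻¹
  field
    Carrier : Set
    _∙_     : Carrier → Carrier → Carrier
    ε       : Carrier
    _⁻¹     : Carrier → Carrier
    isGroup : IsGroup _≡_ _∙_ ε _⁻¹

record NormalSubgroup (G : PGroup) : Set₁ where
  open PGroup G
  field
    mem     : Carrier → Set
    ε∈      : mem ε
    ∙-closed : ∀ {a b} → mem a → mem b → mem (a ∙ b)
    ⁻¹-closed : ∀ {a} → mem a → mem (a ⁻¹)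
    normal  : ∀ g {a} → mem a → mem (g ∙ a ∙ g ⁻¹)

module _ {G : PGroup} where
  open PGroup G

  SameCoset : NormalSubgroup G → Carrier → Carrier → Set
  SameCoset N a b = NormalSubgroup.mem N (a ⁻¹ ∙ b)

  Coset : NormalSubgroup G → Carrier → Carrier → Set
  Coset N r g = SameCoset N r g

  _∘ᶜ_ : (Carrier → Set) → (Carrier → Set) → Carrier → Set
  (P ∘ᶜ Q) g = ∃[ a ] ∃[ b ] (P a × Q b × g ≡ a ∙ b)

-- An isomorphism  G/H → G'/K , written on representatives:
-- f maps the coset aH to the coset (f a)K.

record QuotientIso {G G' : PGroup} (H : NormalSubgroup G) (K : NormalSubgroup G') : Set where
  open PGroup G  renaming (Carrier to C ; _∙_ to _∙₁_)
  open PGroup G' renaming (Carrier to C' ; _∙_ to _∙₂_)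
  field
    f           : C → C'
    well-defined : ∀ a b → SameCoset H a b → SameCoset K (f a) (f b)
    injective   : ∀ a b → SameCoset K (f a) (f b) → SameCoset H a b
    surjective  : ∀ c → ∃[ a ] SameCoset K (f a) c
    homo        : ∀ a b → SameCoset K (f (a ∙₁ b)) (f a ∙₂ f b)

-- Enumeration without repetitions of the cosets of H, with index 0 ↦ H.
-- (The ordinal κ is represented by an index type Idx with a
--  distinguished element zero.)

record CosetEnum {G : PGroup} (H : NormalSubgroup G) : Set₁ where
  open PGroup G
  field
    Idx       : Set
    zero      : Idx
    rep       : Idx → Carrier
    rep-zero  : NormalSubgroup.mem H (rep zero)
    no-repeat : ∀ i j → SameCoset H (rep i) (rep j) → i ≡ j
    covers    : ∀ g → ∃[ i ] Coset H (rep i) g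

record GroupPair : Set₁ where
  field
    I     : Set
    G     : I → PGroup
    E     : I → I → Set
    E-equiv : IsEquivalence E
    H     : ∀ {x y} → E x y → NormalSubgroup (G x)
    K     : ∀ {x y} → E x y → NormalSubgroup (G y)
    φ     : ∀ {x y} (e : E x y) → QuotientIso (H e) (K e)
    enum  : ∀ {x y} (e : E x y) → CosetEnum (H e)

  U : Set
  U = Σ I (λ x → PGroup.Carrier (G x))

  κ : ∀ {x y} → E x y → Set
  κ e = CosetEnum.Idx (enum e)

  Hc : ∀ {x y} (e : E x y) → κ e → PGroup.Carrier (G x) → Set
  Hc e γ = Coset (H e) (CosetEnum.rep (enum e) γ)

  Kc : ∀ {x y} (e : E x y) → κ e → PGroup.Carrier (G y) → Set
  Kc e γ = Coset (K e) (QuotientIso.f (φ e) (CosetEnum.rep (enum e) γ))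

  R : ∀ {x y} (e : E x y) → κ e → U → U → Set
  R {x} {y} e α u v =
    Σ (κ e) λ γ → Σ (PGroup.Carrier (G x)) λ g → Σ (PGroup.Carrier (G y)) λ h → (u ≡ (x , g) × v ≡ (y , h) × Hc e γ g × (_∘ᶜ_ {G y} (Kc e γ) (Kc e α)) h)

  RIdx : Set
  RIdx = Σ I (λ x → Σ I (λ y → Σ (E x y) (λ e → κ e)))

  Rᵢ : RIdx → U → U → Set
  Rᵢ (x , y , e , α) = R e α

  -- the set A of frame relations: unions of subfamilies of the R_{xy,α}
  -- (relations compared extensionally)
  InA : (U → U → Set) → Set₁
  InA S = Σ (RIdx → Set) (λ P → ∀ u v → S u v ⇔ (∃[ i ] (P i × Rᵢ i u v)))

  idU : U → U → Set
  idU u v = u ≡ v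

_⁻¹ʳ : {U : Set} → (U → U → Set) → U → U → Set
(S ⁻¹ʳ) u v = S v u

module Submission where

-- Write f for the representative map of φ_xy and a_α for the chosen
-- representative of H_{xy,α}.  Unfolding the definition, R_{xy,α} relates
-- g ∈ G_x to h ∈ G_y exactly when h ∈ f(g) f(a_α) K_xy.  Hence, with
-- s = f(a_β)⁻¹ f(a_α), the converse R_{xy,β}⁻¹ is the right translation
-- h ↦ h s on G_y followed by R_{xy,α}⁻¹.  Right translation by any element
-- of a group G_y, followed by a basic relation R_{yz,δ}, is again a basic
-- relation R_{yz,δ'}; since A consists of unions of basic relations, A is
-- closed under precomposition with translations.  So R_{xy,α}⁻¹ ∈ A gives
-- R_{xy,β}⁻¹ ∈ A for every β, and the converse implication uses the index 0.

open import Defs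
open import Data.Product using (Σ; ∃; ∃-syntax; _×_; _,_)
open import Function.Bundles using (_⇔_; mk⇔; Equivalence)
import Function.Properties.Equivalence as ⇔
open import Relation.Binary.Bundles using (Setoid)
open import Relation.Binary.Structures using (IsEquivalence)
open import Relation.Binary.PropositionalEquality as ≡ using (_≡_; refl; subst)
open import Algebra.Bundles using (Group)
import Algebra.Properties.Group as GroupProperties
import Relation.Binary.Reasoning.Setoid as SetoidReasoning

asGroup : PGroup → Group _ _
asGroup G = record { isGroup = PGroup.isGroup G }

module CosetCongruence (G : PGroup) (N : NormalSubgroup G) where
  open PGroup G
  open NormalSubgroup N
  open Group (asGroup G) using (assoc; inverseˡ)
  open GroupProperties (asGroup G)
    using (⁻¹-involutive; ⁻¹-anti-homo-∙; \\-leftDividesˡ; \\-leftDividesʳ; //-rightDividesʳ)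

  infix 4 _~_
  _~_ : Carrier → Carrier → Set
  a ~ b = SameCoset N a b

  ~-refl : ∀ {a} → a ~ a
  ~-refl {a} = subst mem (≡.sym (inverseˡ a)) ε∈

  ~-sym : ∀ {a b} → a ~ b → b ~ a
  ~-sym {a} {b} p = subst mem inverse-of-quotient (⁻¹-closed p)
    where
    inverse-of-quotient : (a ⁻¹ ∙ b) ⁻¹ ≡ b ⁻¹ ∙ a
    inverse-of-quotient = ≡.trans (⁻¹-anti-homo-∙ (a ⁻¹) b) (≡.cong (b ⁻¹ ∙_) (⁻¹-involutive a))

  ~-trans : ∀ {a b c} → a ~ b → b ~ c → a ~ c
  ~-trans {a} {b} {c} p q = subst mem telescope (∙-closed p q)
    where
    telescope : (a ⁻¹ ∙ b) ∙ (b ⁻¹ ∙ c) ≡ a ⁻¹ ∙ c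
    telescope = ≡.trans (assoc (a ⁻¹) b (b ⁻¹ ∙ c)) (≡.cong (a ⁻¹ ∙_) (\\-leftDividesˡ b c))

  ~-isEquivalence : IsEquivalence _~_
  ~-isEquivalence = record { refl = ~-refl ; sym = ~-sym ; trans = ~-trans }

  ~-setoid : Setoid _ _
  ~-setoid = record { isEquivalence = ~-isEquivalence }

  ~-congˡ : ∀ {a a'} t → a ~ a' → t ∙ a ~ t ∙ a'
  ~-congˡ {a} {a'} t = subst mem cancel-t
    where
    cancel-t : a ⁻¹ ∙ a' ≡ (t ∙ a) ⁻¹ ∙ (t ∙ a')
    cancel-t = begin
      a ⁻¹ ∙ a'                 ≡⟨ ≡.cong (a ⁻¹ ∙_) (≡.sym (\\-leftDividesʳ t a')) ⟩
      a ⁻¹ ∙ (t ⁻¹ ∙ (t ∙ a'))  ≡⟨ ≡.sym (assoc (a ⁻¹) (t ⁻¹) (t ∙ a')) ⟩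
      (a ⁻¹ ∙ t ⁻¹) ∙ (t ∙ a')  ≡⟨ ≡.cong (_∙ (t ∙ a')) (≡.sym (⁻¹-anti-homo-∙ t a)) ⟩
      (t ∙ a) ⁻¹ ∙ (t ∙ a')     ∎
      where open ≡.≡-Reasoning

  -- Right multiplication needs normality: (at)⁻¹(a't) = t⁻¹(a⁻¹a')t.
  ~-congʳ : ∀ {a a'} t → a ~ a' → a ∙ t ~ a' ∙ t
  ~-congʳ {a} {a'} t p = subst mem conjugate (normal (t ⁻¹) p)
    where
    conjugate : t ⁻¹ ∙ (a ⁻¹ ∙ a') ∙ t ⁻¹ ⁻¹ ≡ (a ∙ t) ⁻¹ ∙ (a' ∙ t)
    conjugate = begin
      t ⁻¹ ∙ (a ⁻¹ ∙ a') ∙ t ⁻¹ ⁻¹  ≡⟨ ≡.cong (t ⁻¹ ∙ (a ⁻¹ ∙ a') ∙_) (⁻¹-involutive t) ⟩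
      t ⁻¹ ∙ (a ⁻¹ ∙ a') ∙ t        ≡⟨ ≡.cong (_∙ t) (≡.sym (assoc (t ⁻¹) (a ⁻¹) a')) ⟩
      t ⁻¹ ∙ a ⁻¹ ∙ a' ∙ t          ≡⟨ assoc (t ⁻¹ ∙ a ⁻¹) a' t ⟩
      (t ⁻¹ ∙ a ⁻¹) ∙ (a' ∙ t)      ≡⟨ ≡.cong (_∙ (a' ∙ t)) (≡.sym (⁻¹-anti-homo-∙ a t)) ⟩
      (a ∙ t) ⁻¹ ∙ (a' ∙ t)         ∎
      where open ≡.≡-Reasoning

  ~-cancelʳ : ∀ {a a'} t → a ∙ t ~ a' ∙ t → a ~ a'
  ~-cancelʳ {a} {a'} t p =
    ≡.subst₂ _~_ (//-rightDividesʳ t a) (//-rightDividesʳ t a') (~-congʳ (t ⁻¹) p)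

module _ (F : GroupPair) where
  open GroupPair F

  f : ∀ {x y} (e : E x y) → PGroup.Carrier (G x) → PGroup.Carrier (G y)
  f e = QuotientIso.f (φ e)

  rep : ∀ {x y} (e : E x y) → κ e → PGroup.Carrier (G x)
  rep e = CosetEnum.rep (enum e)

  Related : ∀ {x y} (e : E x y) → κ e → PGroup.Carrier (G x) → PGroup.Carrier (G y) → Set
  Related {y = y} e α g h = SameCoset (K e) (PGroup._∙_ (G y) (f e g) (f e (rep e α))) h

  -- Every pair satisfying the criterion is in R_{xy,α}: take γ with g ∈ H_γ
  -- and split h = (h f(a_α)⁻¹) · f(a_α).
  R-intro : ∀ {x y} (e : E x y) α g h → Related e α g h → R e α (x , g) (y , h)
  R-intro {y = y} e α g h related
    with γ , g∈Hγ ← CosetEnum.covers (enum e) g =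
    γ , g , h , refl , refl , g∈Hγ , h ∙ fa ⁻¹ , fa , fγ~hfa⁻¹ , ~-refl , ≡.sym (//-rightDividesˡ fa h)
    where
    open PGroup (G y)
    open CosetCongruence (G y) (K e)
    open GroupProperties (asGroup (G y)) using (//-rightDividesˡ; //-rightDividesʳ)
    fa = f e (rep e α)
    fγ~hfa⁻¹ : f e (rep e γ) ~ h ∙ fa ⁻¹
    fγ~hfa⁻¹ = begin
      f e (rep e γ)          ≈⟨ QuotientIso.well-defined (φ e) _ _ g∈Hγ ⟩
      f e g                  ≡⟨ //-rightDividesʳ fa (f e g) ⟨
      (f e g ∙ fa) ∙ fa ⁻¹   ≈⟨ ~-congʳ (fa ⁻¹) related ⟩
      h ∙ fa ⁻¹              ∎
      where open SetoidReasoning ~-setoid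

  R-elim : ∀ {x y} (e : E x y) α u v → R e α u v →
           Σ (PGroup.Carrier (G x)) λ g → Σ (PGroup.Carrier (G y)) λ h →
             u ≡ (x , g) × v ≡ (y , h) × Related e α g h
  R-elim {y = y} e α u v (γ , g , _ , u≡ , v≡ , g∈Hγ , a , b , a∈Kγ , b∈Kα , refl) =
    g , a ∙ b , u≡ , v≡ , ~-trans (~-congʳ _ fg~a) (~-congˡ a b∈Kα)
    where
    open PGroup (G y)
    open CosetCongruence (G y) (K e)
    fg~a : f e g ~ a
    fg~a = ~-trans (~-sym (QuotientIso.well-defined (φ e) _ _ g∈Hγ)) a∈Kγ

  infix 4 _≐_
  _≐_ : (U → U → Set) → (U → U → Set) → Set
  S ≐ T = ∀ u v → S u v ⇔ T u v

  InA-resp : ∀ {S T} → S ≐ T → InA S → InA T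
  InA-resp S≐T (P , S≐⋃P) = P , λ u v → ⇔.trans (⇔.sym (S≐T u v)) (S≐⋃P u v)

  infixr 9 _⨾_
  _⨾_ : (U → U → Set) → (U → U → Set) → U → U → Set
  (S ⨾ T) u v = ∃ λ w → S u w × T w v

  Translate : (y : I) → PGroup.Carrier (G y) → U → U → Set
  Translate y s u w = Σ (PGroup.Carrier (G y)) λ h → u ≡ (y , h) × w ≡ (y , PGroup._∙_ (G y) h s)

  -- Translation followed by a basic relation out of G_y is basic again:
  -- s a_δ lies in some coset H_{δ'}, and f(hs) f(a_δ) ∈ f(h) f(a_δ') K.
  translate-basic : ∀ {y z} (e : E y z) δ s →
                    Σ (κ e) λ δ' → R e δ' ≐ (Translate y s ⨾ R e δ)
  translate-basic {y} {z} e δ s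
    with δ' , saδ∈Hδ' ← CosetEnum.covers (enum e) (PGroup._∙_ (G y) s (rep e δ)) =
    δ' , λ u v → mk⇔ (to u v) (from u v)
    where
    open PGroup (G y) using (_∙_)
    open PGroup (G z) using () renaming (_∙_ to _·_)
    open CosetCongruence (G z) (K e)
    shift-index : ∀ h → f e (h ∙ s) · f e (rep e δ) ~ f e h · f e (rep e δ')
    shift-index h = begin
      f e (h ∙ s) · f e (rep e δ)          ≈⟨ ~-congʳ _ (QuotientIso.homo (φ e) h s) ⟩
      (f e h · f e s) · f e (rep e δ)      ≡⟨ ·-assoc (f e h) (f e s) (f e (rep e δ)) ⟩
      f e h · (f e s · f e (rep e δ))      ≈⟨ ~-congˡ (f e h) (QuotientIso.homo (φ e) s (rep e δ)) ⟨
      f e h · f e (s ∙ rep e δ)            ≈⟨ ~-congˡ (f e h) (QuotientIso.well-defined (φ e) _ _ saδ∈Hδ') ⟨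
      f e h · f e (rep e δ')               ∎
      where
      open SetoidReasoning ~-setoid
      open Group (asGroup (G z)) using () renaming (assoc to ·-assoc)
    to : ∀ u v → R e δ' u v → (Translate y s ⨾ R e δ) u v
    to u v r with R-elim e δ' u v r
    ... | h , g , refl , refl , related =
      (y , h ∙ s) , (h , refl , refl) , R-intro e δ (h ∙ s) g (~-trans (shift-index h) related)
    from : ∀ u v → (Translate y s ⨾ R e δ) u v → R e δ' u v
    from u v (w , (h , refl , refl) , r) with R-elim e δ w v r
    ... | _ , g , refl , refl , related = R-intro e δ' h g (~-trans (~-sym (shift-index h)) related)

  -- A is closed under precomposition with a translation: translate each
  -- member of the union separately (members not starting in G_y contribute nothing).
  InA-translate : ∀ {S} y s → InA S → InA (Translate y s ⨾ S)
  InA-translate {S} y s (P , S≐⋃P) = P' , λ u v → mk⇔ (to u v) (from u v)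
    where
    P' : RIdx → Set
    P' i = Σ RIdx λ j → P j × (Rᵢ i ≐ (Translate y s ⨾ Rᵢ j))
    to : ∀ u v → (Translate y s ⨾ S) u v → ∃[ i ] (P' i × Rᵢ i u v)
    to u v (w , t , Swv) with Equivalence.to (S≐⋃P w v) Swv
    to u v (_ , (h , refl , refl) , _) | (_ , z , e , δ) , Pj , r@(_ , _ , _ , refl , _)
      with δ' , δ'≐ ← translate-basic e δ s =
      (y , z , e , δ') , ((y , z , e , δ) , Pj , δ'≐) , Equivalence.from (δ'≐ u v) (_ , (h , refl , refl) , r)
    from : ∀ u v → ∃[ i ] (P' i × Rᵢ i u v) → (Translate y s ⨾ S) u v
    from u v (i , (j , Pj , i≐) , Riuv) with Equivalence.to (i≐ u v) Riuv
    ... | w , t , Rjwv = w , t , Equivalence.from (S≐⋃P w v) (j , Pj , Rjwv)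

  shift : ∀ {x y} (e : E x y) → κ e → κ e → PGroup.Carrier (G y)
  shift {y = y} e α β = PGroup._∙_ (G y) (PGroup._⁻¹ (G y) (f e (rep e β))) (f e (rep e α))

  -- The converse of R_{xy,β} is translation by s = shift e α β followed by
  -- the converse of R_{xy,α}, because f(g) f(a_β) · s = f(g) f(a_α).
  converse-shift : ∀ {x y} (e : E x y) α β → (R e β ⁻¹ʳ) ≐ (Translate y (shift e α β) ⨾ R e α ⁻¹ʳ)
  converse-shift {y = y} e α β u v = mk⇔ to from
    where
    open PGroup (G y)
    open CosetCongruence (G y) (K e)
    open Group (asGroup (G y)) using (assoc)
    open GroupProperties (asGroup (G y)) using (\\-leftDividesˡ)
    fa = f e (rep e α)
    fb = f e (rep e β)
    s = shift e α β
    absorb : ∀ c → (c ∙ fb) ∙ s ≡ c ∙ fa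
    absorb c = ≡.trans (assoc c fb s) (≡.cong (c ∙_) (\\-leftDividesˡ fb fa))
    to : R e β v u → (Translate y s ⨾ R e α ⁻¹ʳ) u v
    to r with R-elim e β v u r
    ... | g , h , refl , refl , related =
      (y , h ∙ s) , (h , refl , refl) , R-intro e α g (h ∙ s) (subst (_~ h ∙ s) (absorb (f e g)) (~-congʳ s related))
    from : (Translate y s ⨾ R e α ⁻¹ʳ) u v → R e β v u
    from (w , (h , refl , refl) , r) with R-elim e α v w r
    ... | g , _ , refl , refl , related =
      R-intro e β g h (~-cancelʳ s (subst (_~ h ∙ s) (≡.sym (absorb (f e g))) related))

corollary4p6 : (F : GroupPair) → GroupPair.InA F (GroupPair.idU F) →
    ∀ {x y} (e : GroupPair.E F x y) →
    (∃[ α ] GroupPair.InA F (GroupPair.R F e α ⁻¹ʳ)) ⇔ (∀ α → GroupPair.InA F (GroupPair.R F e α ⁻¹ʳ))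
corollary4p6 F _ {y = y} e = mk⇔ some⇒all (λ all → CosetEnum.zero (GroupPair.enum F e) , all _)
  where
  some⇒all : (∃[ α ] GroupPair.InA F (GroupPair.R F e α ⁻¹ʳ)) → ∀ β → GroupPair.InA F (GroupPair.R F e β ⁻¹ʳ)
  some⇒all (α , Rα⁻¹∈A) β =
    InA-resp F (λ u v → ⇔.sym (converse-shift F e α β u v)) (InA-translate F y (shift F e α β) Rα⁻¹∈A)
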